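{- Let $T$ be a tournament and let $P=u_0u_1\ldots u_{p-1}$ be a non-extendable (nonhamiltonian) directed path on $p\ge 4$ vertices in $T$. Let $P'=u_1u_2\ldots u_{p-2}$. If $P'$ has a hybrid vertex, then $h(P)\le i(T)+2$.
   Context: A nonhamiltonian path $P$ in $T$ is extendable if there is a path $P'$ with the same initial and terminal vertices as $P$ and $V(P')=V(P)\cup\{w\}$ for some $w\in V(T)\setminus V(P)$; non-extendable means not extendable. For a path $Q$ (here $Q=P$ or a subpath of $P$) and a vertex $w\in V(T)\setminus V(P)$: $w$ is a dominating vertex of $Q$ if $w$ sends an arc to every vertex of $Q$, a dominated vertex of $Q$ if every vertex of $Q$ sends an arc to $w$, and a hybrid vertex of $Q$ otherwise. $H(P)$ is the set of hybrid vertices of $P$ and $h(P)=|H(P)|$. The irregularity is $i(T)=\max\{|d^+(u)-d^-(u)|: u\in V(T)\}$. -}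

module Defs where

open import Data.Nat using (ℕ; _⊔_; ∣_-_∣)
open import Data.Bool using (Bool; true; false)
import Data.Bool as B
open import Data.Fin using (Fin)
import Data.Fin as F
open import Data.List using (List; allFin; length; filter; map; foldr; take; drop; head; last)
open import Data.List.Membership.Propositional using (_∈_; _∉_)
open import Data.List.Relation.Unary.All using (All; all?)
open import Data.List.Relation.Unary.Unique.Propositional using (Unique)
open import Data.List.Relation.Unary.Linked using (Linked)
import Data.List.Membership.DecPropositional as DecMem
open import Data.Product using (Σ; _×_)
open import Data.Sum using (_⊎_)
open import Relation.Binary.PropositionalEquality using (_≡_; _≢_)
open import Relation.Nullary using (¬_; Dec)
open import Relation.Nullary.Decidable using (¬?; _×-dec_)
open import Function.Bundles using (_⇔_)

record Tournament (n : ℕ) : Set where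
  field
    arc     : Fin n → Fin n → Bool
    irrefl  : ∀ u → arc u u ≡ false
    total   : ∀ u v → u ≢ v → arc u v ≡ true ⊎ arc v u ≡ true
    asym    : ∀ u v → arc u v ≡ true → arc v u ≡ false

module _ {n : ℕ} (T : Tournament n) where
  open Tournament T
  open DecMem (F._≟_ {n}) using (_∉?_)

  Arc : Fin n → Fin n → Set
  Arc u v = arc u v ≡ true

  Arc? : ∀ u v → Dec (Arc u v)
  Arc? u v = arc u v B.≟ true

  outdeg indeg : Fin n → ℕ
  outdeg u = length (filter (Arc? u) (allFin n))
  indeg  u = length (filter (λ v → Arc? v u) (allFin n))

  irregularity : ℕ
  irregularity = foldr _⊔_ 0 (map (λ u → ∣ outdeg u - indeg u ∣) (allFin n))

  IsPath : List (Fin n) → Set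
  IsPath P = Unique P × Linked Arc P

  Extendable : List (Fin n) → Set
  Extendable P = Σ (List (Fin n)) λ P' → Σ (Fin n) λ w →
    IsPath P' × w ∉ P × head P' ≡ head P × last P' ≡ last P ×
    (∀ x → (x ∈ P') ⇔ (x ∈ P ⊎ x ≡ w))

  Dominating Dominated : Fin n → List (Fin n) → Set
  Dominating w Q = All (λ x → Arc w x) Q
  Dominated  w Q = All (λ x → Arc x w) Q

  Hybrid : List (Fin n) → List (Fin n) → Fin n → Set
  Hybrid P Q w = w ∉ P × ¬ Dominating w Q × ¬ Dominated w Q

  Hybrid? : ∀ P Q w → Dec (Hybrid P Q w)
  Hybrid? P Q w = (w ∉? P) ×-dec (¬? (all? (Arc? w) Q) ×-dec ¬? (all? (λ x → Arc? x w) Q))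

  h : List (Fin n) → ℕ
  h P = length (filter (Hybrid? P P) (allFin n))

inner : ∀ {A : Set} → List A → List A
inner P = take (length P Data.Nat.∸ 2) (drop 1 P)

-- Write P = u₀ Q uₗ with Q = P′. Non-extendability means no outside vertex v can be
-- inserted between consecutive vertices c d of P, so c → v forces d → v; hence a
-- hybrid vertex v of P satisfies v → u₀ and uₗ → v, and for every other outside vertex
-- u₀ → v forces uₗ → v and v → uₗ forces v → u₀. A hybrid vertex w of Q closes Q into a
-- cycle w → Q → w, and cutting that cycle shows: if a b are consecutive on Q and
-- u₀ → b, then uₗ → a. So inside P the out-arcs of u₀ exceed the in-arcs of uₗ by at
-- most one. Summing over all vertices gives
--   2 h(P) + d⁺(u₀) + d⁻(uₗ) ≤ d⁻(u₀) + d⁺(uₗ) + 4,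
-- and |d⁺ - d⁻| ≤ i(T) at u₀ and uₗ yields h(P) ≤ i(T) + 2.
module Submission where

open import Defs
open import Data.Fin using (Fin)
import Data.Fin as Fin
open import Data.List
  using (List; []; _∷_; _++_; _∷ʳ_; [_]; length; map; filter; foldr; head; last; take; allFin; initLast; _∷ʳ′_)
open import Data.List.Properties using (++-assoc; map-++; length-++)
open import Data.List.Membership.Propositional using (_∈_; _∉_)
open import Data.List.Membership.Propositional.Properties
  using (∈-++⁺ˡ; ∈-++⁺ʳ; ∈-filter⁺; ∈-filter⁻; ∈-allFin)
open import Data.List.Membership.Propositional.Properties.WithK using (unique∧set⇒bag)
import Data.List.Membership.DecPropositional as DecMembership
open import Data.List.Relation.Binary.BagAndSetEquality using (∼bag⇒↭)
open import Data.List.Relation.Binary.Permutation.Propositional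
  using (_↭_; ↭-refl; ↭-sym; ↭-trans; ↭-prep; ↭-swap; ↭⇒↭ₛ; module PermutationReasoning)
open import Data.List.Relation.Binary.Permutation.Propositional.Properties
  using (shift; shifts; ++⁺ˡ; ∷↭∷ʳ; ∈-resp-↭) renaming (map⁺ to map⁺-↭)
import Data.List.Relation.Binary.Permutation.Setoid.Properties as Permutationₛ
open import Data.List.Relation.Unary.All using (All; []; _∷_)
import Data.List.Relation.Unary.All as All
open import Data.List.Relation.Unary.All.Properties using (¬Any⇒All¬)
open import Data.List.Relation.Unary.Any using (here; there)
open import Data.List.Relation.Unary.Linked using (Linked; []; [-]; _∷_)
import Data.List.Relation.Unary.Linked as Linked
open import Data.List.Relation.Unary.Unique.Propositional using (Unique; _∷_)
import Data.List.Relation.Unary.Unique.Propositional.Properties as Unique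
open import Data.Nat using (ℕ; suc; _+_; _∸_; _≤_; _<_; _⊔_; ∣_-_∣; z≤n; s≤s)
open import Data.Nat.ListAction using (sum)
open import Data.Nat.ListAction.Properties using (sum-++; sum-↭)
open import Data.Nat.Properties
  using (≤-refl; ≤-reflexive; ≤-trans; +-mono-≤; +-monoˡ-≤; +-monoʳ-≤; +-mono-<; +-cancelʳ-≤;
         +-assoc; +-comm; m≤m+n; m≤n+m; m≤m⊔n; m≤n⊔m; m≤n+∣n-m∣; m≤n+∣m-n∣; m+n∸n≡m; +-identityʳ;
         ≮⇒≥; <⇒≱; module ≤-Reasoning; +-commutativeSemigroup)
open import Data.Nat.Tactic.RingSolver using (solve)
-- The solver's variable lists are written with List.∷: with _∷_ overloaded (List, All,
-- Linked, Unique) the macro argument cannot be elaborated.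
import Data.List.Base as List
open import Algebra.Properties.CommutativeSemigroup +-commutativeSemigroup using (interchange; x∙yz≈y∙xz; xy∙z≈xz∙y)
open import Data.Product using (∃; _×_; _,_; proj₁; proj₂)
open import Data.Sum using (_⊎_; inj₁; inj₂)
open import Function.Base using (_∘_)
open import Function.Bundles using (mk⇔)
open import Relation.Binary.Definitions using (DecidableEquality)
open import Relation.Binary.PropositionalEquality
  using (_≡_; _≢_; refl; sym; trans; cong; cong₂; subst; module ≡-Reasoning)
open import Relation.Binary.PropositionalEquality.Properties using (setoid)
open import Relation.Nullary using (¬_; Dec; yes; no; ¬?; contradiction)
open import Relation.Unary using (Decidable)

private
  variable
    A B C : Set

𝟙 : Dec B → ℕ
𝟙 (yes _) = 1
𝟙 (no _)  = 0

𝟙≤1 : (d : Dec B) → 𝟙 d ≤ 1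
𝟙≤1 (yes _) = ≤-refl
𝟙≤1 (no _)  = z≤n

𝟙-yes : (d : Dec B) → B → 𝟙 d ≡ 1
𝟙-yes (yes _) _ = refl
𝟙-yes (no ¬b) b = contradiction b ¬b

𝟙-no : (d : Dec B) → ¬ B → 𝟙 d ≡ 0
𝟙-no (yes b) ¬b = contradiction b ¬b
𝟙-no (no _)  _  = refl

𝟙-mono : (d : Dec B) (e : Dec C) → (B → C) → 𝟙 d ≤ 𝟙 e
𝟙-mono (yes b) e f = ≤-reflexive (sym (𝟙-yes e (f b)))
𝟙-mono (no _)  _ _ = z≤n

𝟙-exclusive : (d : Dec B) (e : Dec C) → (B → ¬ C) → (¬ B → C) → 𝟙 d + 𝟙 e ≡ 1
𝟙-exclusive (yes b)  (yes c)  b⇒¬c _ = contradiction c (b⇒¬c b)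
𝟙-exclusive (yes _)  (no _)   _    _ = refl
𝟙-exclusive (no _)   (yes _)  _    _ = refl
𝟙-exclusive (no ¬b)  (no ¬c)  _ ¬b⇒c = contradiction (¬b⇒c ¬b) ¬c

∑ : List A → (A → ℕ) → ℕ
∑ xs f = sum (map f xs)

∑-++ : ∀ xs ys (f : A → ℕ) → ∑ (xs ++ ys) f ≡ ∑ xs f + ∑ ys f
∑-++ xs ys f = trans (cong sum (map-++ f xs ys)) (sum-++ (map f xs) (map f ys))

∑-∷-∷ʳ : ∀ (x : A) xs y f → ∑ (x ∷ xs ∷ʳ y) f ≡ f x + ∑ xs f + f y
∑-∷-∷ʳ x xs y f = begin
  f x + ∑ (xs ∷ʳ y) f        ≡⟨ cong (f x +_) (∑-++ xs [ y ] f) ⟩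
  f x + (∑ xs f + (f y + 0)) ≡⟨ cong (λ k → f x + (∑ xs f + k)) (+-identityʳ (f y)) ⟩
  f x + (∑ xs f + f y)       ≡⟨ +-assoc (f x) (∑ xs f) (f y) ⟨
  f x + ∑ xs f + f y         ∎
  where open ≡-Reasoning

∑-+ : ∀ xs (f g : A → ℕ) → ∑ xs (λ x → f x + g x) ≡ ∑ xs f + ∑ xs g
∑-+ []       f g = refl
∑-+ (x ∷ xs) f g =
  trans (cong (f x + g x +_) (∑-+ xs f g)) (interchange (f x) (g x) (∑ xs f) (∑ xs g))

∑-cong : ∀ {xs} {f g : A → ℕ} → (∀ {x} → x ∈ xs → f x ≡ g x) → ∑ xs f ≡ ∑ xs g
∑-cong {xs = []}     _ = refl
∑-cong {xs = x ∷ xs} f≗g = cong₂ _+_ (f≗g (here refl)) (∑-cong (f≗g ∘ there))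

∑-mono : ∀ {xs} {f g : A → ℕ} → (∀ {x} → x ∈ xs → f x ≤ g x) → ∑ xs f ≤ ∑ xs g
∑-mono {xs = []}     _ = z≤n
∑-mono {xs = x ∷ xs} f≤g = +-mono-≤ (f≤g (here refl)) (∑-mono (f≤g ∘ there))

∑-↭ : ∀ {xs ys} (f : A → ℕ) → xs ↭ ys → ∑ xs f ≡ ∑ ys f
∑-↭ f xs↭ys = sum-↭ (map⁺-↭ f xs↭ys)

∑-complementary : ∀ xs (f g : A → ℕ) → (∀ {x} → x ∈ xs → f x + g x ≡ 1) → ∑ xs f + ∑ xs g ≡ length xs
∑-complementary []       f g _     = refl
∑-complementary (x ∷ xs) f g f+g≡1 = begin
  f x + ∑ xs f + (g x + ∑ xs g)   ≡⟨ interchange (f x) (∑ xs f) (g x) (∑ xs g) ⟩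
  f x + g x + (∑ xs f + ∑ xs g)   ≡⟨ cong₂ _+_ (f+g≡1 (here refl)) (∑-complementary xs f g (f+g≡1 ∘ there)) ⟩
  suc (length xs)                 ∎
  where open ≡-Reasoning

-- Each link R c d pays for f d with g c, so the sum of f over all but the first element
-- is at most the sum of g over all elements.
∑-≤-shift : ∀ {R : A → A → Set} {f g : A → ℕ} xs → Linked R xs → (∀ {c d} → R c d → f d ≤ g c) →
            (∀ x → f x ≤ 1) → ∑ xs f ≤ suc (∑ xs g)
∑-≤-shift []       _      _    _   = z≤n
∑-≤-shift {R = R} {f} {g} (x ∷ xs) linked step f≤1 = +-mono-≤ (f≤1 x) (shifted linked)
  where
  shifted : ∀ {y ys} → Linked R (y ∷ ys) → ∑ ys f ≤ ∑ (y ∷ ys) g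
  shifted [-]       = z≤n
  shifted (r ∷ rs) = +-mono-≤ (step r) (shifted rs)

length-filter≡∑𝟙 : ∀ {P : A → Set} (P? : Decidable P) xs → length (filter P? xs) ≡ ∑ xs (𝟙 ∘ P?)
length-filter≡∑𝟙 P? []       = refl
length-filter≡∑𝟙 P? (x ∷ xs) with P? x
... | yes _ = cong suc (length-filter≡∑𝟙 P? xs)
... | no _  = length-filter≡∑𝟙 P? xs

∑-filter : ∀ {P : A → Set} (P? : Decidable P) xs (f : A → ℕ) →
           ∑ xs f ≡ ∑ (filter P? xs) f + ∑ (filter (¬? ∘ P?) xs) f
∑-filter P? []       f = refl
∑-filter P? (x ∷ xs) f with P? x
... | yes _ = trans (cong (f x +_) (∑-filter P? xs f)) (sym (+-assoc (f x) _ _))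
... | no _  = trans (cong (f x +_) (∑-filter P? xs f))
                     (x∙yz≈y∙xz (f x) (∑ (filter P? xs) f) (∑ (filter (¬? ∘ P?) xs) f))

≤-foldr-⊔ : ∀ (g : A → ℕ) {x xs} → x ∈ xs → g x ≤ foldr _⊔_ 0 (map g xs)
≤-foldr-⊔ g {xs = y ∷ ys} (here refl) = m≤m⊔n (g y) _
≤-foldr-⊔ g {xs = y ∷ ys} (there x∈)  = ≤-trans (≤-foldr-⊔ g x∈) (m≤n⊔m (g y) _)

∈∧∉⇒≢ : ∀ {x y : A} {xs} → x ∈ xs → y ∉ xs → x ≢ y
∈∧∉⇒≢ x∈ y∉ refl = y∉ x∈

Unique-resp-↭ : ∀ {xs ys : List A} → xs ↭ ys → Unique xs → Unique ys
Unique-resp-↭ xs↭ys = Permutationₛ.Unique-resp-↭ (setoid _) (↭⇒↭ₛ xs↭ys)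

module _ (_≟_ : DecidableEquality A) where
  open DecMembership _≟_ using (_∈?_; _∉?_)

  filter-∈↭ : ∀ {xs} ys → (∀ x → x ∈ xs) → Unique xs → Unique ys → filter (_∈? ys) xs ↭ ys
  filter-∈↭ {xs} ys all∈ xs-unique ys-unique =
    ∼bag⇒↭ (unique∧set⇒bag (Unique.filter⁺ (_∈? ys) xs-unique) ys-unique
      (mk⇔ (λ x∈ → proj₂ (∈-filter⁻ (_∈? ys) {xs = xs} x∈)) (∈-filter⁺ (_∈? ys) {xs = xs} (all∈ _))))

  ∑-≤-by-parts : ∀ {xs} ys (f g : A → ℕ) k → (∀ x → x ∈ xs) → Unique xs → Unique ys →
                 (∀ {x} → x ∉ ys → f x ≤ g x) → ∑ ys f ≤ ∑ ys g + k → ∑ xs f ≤ ∑ xs g + k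
  ∑-≤-by-parts {xs} ys f g k all∈ xs-unique ys-unique outside inside = begin
    ∑ xs f                  ≡⟨ split f ⟩
    ∑ ys f + ∑ rest f       ≤⟨ +-mono-≤ inside (∑-mono (outside ∘ proj₂ ∘ ∈-filter⁻ (_∉? ys) {xs = xs})) ⟩
    ∑ ys g + k + ∑ rest g   ≡⟨ xy∙z≈xz∙y (∑ ys g) k (∑ rest g) ⟩
    ∑ ys g + ∑ rest g + k   ≡⟨ cong (_+ k) (split g) ⟨
    ∑ xs g + k              ∎
    where
    open ≤-Reasoning
    rest = filter (_∉? ys) xs
    split : ∀ h → ∑ xs h ≡ ∑ ys h + ∑ rest h
    split h = trans (∑-filter (_∈? ys) xs h) (cong (_+ ∑ rest h) (∑-↭ h (filter-∈↭ ys all∈ xs-unique ys-unique)))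

module _ {R : A → A → Set} where

  Linked-++⁻ˡ : ∀ xs {ys} → Linked R (xs ++ ys) → Linked R xs
  Linked-++⁻ˡ []            _       = []
  Linked-++⁻ˡ (x ∷ [])      _       = [-]
  Linked-++⁻ˡ (x ∷ x′ ∷ xs) (r ∷ l) = r ∷ Linked-++⁻ˡ (x′ ∷ xs) l

  Linked-split : ∀ xs {y ys} → Linked R (xs ++ y ∷ ys) → Linked R (xs ∷ʳ y) × Linked R (y ∷ ys)
  Linked-split []            l       = [-] , l
  Linked-split (x ∷ [])      (r ∷ l) = r ∷ [-] , l
  Linked-split (x ∷ x′ ∷ xs) (r ∷ l) with l₁ , l₂ ← Linked-split (x′ ∷ xs) l = r ∷ l₁ , l₂

  Linked-join : ∀ xs {y ys} → Linked R (xs ∷ʳ y) → Linked R (y ∷ ys) → Linked R (xs ++ y ∷ ys)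
  Linked-join []            _        l = l
  Linked-join (x ∷ [])      (r ∷ _)  l = r ∷ l
  Linked-join (x ∷ x′ ∷ xs) (r ∷ l₁) l = r ∷ Linked-join (x′ ∷ xs) l₁ l

  splits⇒Linked : ∀ zs → (∀ xs {a b ys} → xs ++ a ∷ b ∷ ys ≡ zs → R a b) → Linked R zs
  splits⇒Linked []            _    = []
  splits⇒Linked (z ∷ [])      _    = [-]
  splits⇒Linked (z ∷ z′ ∷ zs) R-at =
    R-at [] refl ∷ splits⇒Linked (z′ ∷ zs) (λ xs eq → R-at (z ∷ xs) (cong (z ∷_) eq))

module _ {P : A → Set} where

  propagate-forward : ∀ {x xs} → Linked (λ c d → P c → P d) (x ∷ xs) → P x → All P (x ∷ xs)
  propagate-forward [-]          p = p ∷ []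
  propagate-forward (step ∷ l) p = p ∷ propagate-forward l (step p)

  propagate-backward : ∀ xs {x} → Linked (λ c d → P d → P c) (xs ∷ʳ x) → P x → All P (xs ∷ʳ x)
  propagate-backward []             _          p = p ∷ []
  propagate-backward (_ ∷ [])       (step ∷ _) p = step p ∷ p ∷ []
  propagate-backward (_ ∷ x′ ∷ xs) (step ∷ l) p with ps@(p′ ∷ _) ← propagate-backward (x′ ∷ xs) l p = step p′ ∷ ps

head-++-∷ : ∀ xs {y : A} {ys zs} → head (xs ++ y ∷ ys) ≡ head (xs ++ y ∷ zs)
head-++-∷ []      = refl
head-++-∷ (_ ∷ _) = refl

last-++-∷ : ∀ xs (y : A) ys → last (xs ++ y ∷ ys) ≡ last (y ∷ ys)
last-++-∷ []             y ys = refl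
last-++-∷ (_ ∷ [])       y ys = refl
last-++-∷ (_ ∷ x′ ∷ xs) y ys = last-++-∷ (x′ ∷ xs) y ys

take-length-++ : ∀ (xs : List A) ys → take (length xs) (xs ++ ys) ≡ xs
take-length-++ []       ys = refl
take-length-++ (x ∷ xs) ys = cong (x ∷_) (take-length-++ xs ys)

inner-∷-∷ʳ : ∀ (x : A) xs y → inner (x ∷ xs ∷ʳ y) ≡ xs
inner-∷-∷ʳ x xs y = begin
  take (length (xs ∷ʳ y) ∸ 1) (xs ∷ʳ y)  ≡⟨ cong (λ k → take (k ∸ 1) (xs ∷ʳ y)) (length-++ xs) ⟩
  take (length xs + 1 ∸ 1) (xs ∷ʳ y)     ≡⟨ cong (λ k → take k (xs ∷ʳ y)) (m+n∸n≡m (length xs) 1) ⟩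
  take (length xs) (xs ∷ʳ y)             ≡⟨ take-length-++ xs [ y ] ⟩
  xs                                     ∎
  where open ≡-Reasoning

balance : ∀ {a a′ b b′} → a + a′ ≡ b + b′ → a ≤ suc b → a + b′ ≤ a′ + b + 2
balance {a} {a′} {b} {b′} eq a≤1+b = +-cancelʳ-≤ a (a + b′) (a′ + b + 2) (begin
  a + b′ + a          ≡⟨ solve (a List.∷ b′ List.∷ List.[]) ⟩
  a + a + b′          ≤⟨ +-monoˡ-≤ b′ (+-mono-≤ a≤1+b a≤1+b) ⟩
  suc b + suc b + b′  ≡⟨ solve (b List.∷ b′ List.∷ List.[]) ⟩
  b + b′ + b + 2      ≡⟨ cong (λ t → t + b + 2) eq ⟨
  a + a′ + b + 2      ≡⟨ solve (a List.∷ a′ List.∷ b List.∷ List.[]) ⟩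
  a′ + b + 2 + a      ∎)
  where open ≤-Reasoning

halve : ∀ {h o i o′ i′ I} → h + h + o + i′ ≤ i + o′ + 4 → i ≤ o + I → o′ ≤ i′ + I → h ≤ I + 2
halve {h} {o} {i} {o′} {i′} {I} balanced i≤o+I o′≤i′+I = ≮⇒≥ λ I+2<h → <⇒≱ (+-mono-< I+2<h I+2<h) h+h≤
  where
  open ≤-Reasoning
  h+h≤ : h + h ≤ I + 2 + (I + 2)
  h+h≤ = +-cancelʳ-≤ (o + i′) (h + h) (I + 2 + (I + 2)) (begin
    h + h + (o + i′)          ≡⟨ +-assoc (h + h) o i′ ⟨
    h + h + o + i′            ≤⟨ balanced ⟩
    i + o′ + 4                ≤⟨ +-monoˡ-≤ 4 (+-mono-≤ i≤o+I o′≤i′+I) ⟩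
    o + I + (i′ + I) + 4      ≡⟨ solve (o List.∷ I List.∷ i′ List.∷ List.[]) ⟩
    I + 2 + (I + 2) + (o + i′) ∎)

module _ {n : ℕ} (T : Tournament n) where
  open Tournament T

  infix 4 _⟶_
  _⟶_ : Fin n → Fin n → Set
  _⟶_ = Arc T

  arcℕ : Fin n → Fin n → ℕ
  arcℕ u v = 𝟙 (Arc? T u v)

  ⟶-irreflexive : ∀ {u} → ¬ (u ⟶ u)
  ⟶-irreflexive {u} u⟶u with trans (sym u⟶u) (irrefl u)
  ... | ()

  ⟶-asymmetric : ∀ {u v} → u ⟶ v → ¬ (v ⟶ u)
  ⟶-asymmetric {u} {v} u⟶v v⟶u with trans (sym v⟶u) (asym u v u⟶v)
  ... | ()

  ⟶-connex : ∀ {u v} → u ≢ v → ¬ (u ⟶ v) → v ⟶ u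
  ⟶-connex {u} {v} u≢v ¬u⟶v with total u v u≢v
  ... | inj₁ u⟶v = contradiction u⟶v ¬u⟶v
  ... | inj₂ v⟶u = v⟶u

  arcℕ-pair : ∀ {u v} → u ≢ v → arcℕ u v + arcℕ v u ≡ 1
  arcℕ-pair {u} {v} u≢v = 𝟙-exclusive (Arc? T u v) (Arc? T v u) ⟶-asymmetric (⟶-connex u≢v)

  imbalance≤irregularity : ∀ u → ∣ outdeg T u - indeg T u ∣ ≤ irregularity T
  imbalance≤irregularity u = ≤-foldr-⊔ (λ u → ∣ outdeg T u - indeg T u ∣) (∈-allFin u)

  indeg≤outdeg+irregularity : ∀ u → indeg T u ≤ outdeg T u + irregularity T
  indeg≤outdeg+irregularity u =
    ≤-trans (m≤n+∣n-m∣ (indeg T u) (outdeg T u)) (+-monoʳ-≤ (outdeg T u) (imbalance≤irregularity u))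

  outdeg≤indeg+irregularity : ∀ u → outdeg T u ≤ indeg T u + irregularity T
  outdeg≤indeg+irregularity u =
    ≤-trans (m≤n+∣m-n∣ (outdeg T u) (indeg T u)) (+-monoʳ-≤ (indeg T u) (imbalance≤irregularity u))

  ↭-extension : ∀ {P P′ w} → Unique P → w ∉ P → Linked _⟶_ P′ → P′ ↭ w ∷ P →
                head P′ ≡ head P → last P′ ≡ last P → Extendable T P
  ↭-extension {P} {P′} {w} P-unique w∉P P′-linked P′↭ same-head same-last =
    P′ , w , (P′-unique , P′-linked) , w∉P , same-head , same-last , λ x → mk⇔ to from
    where
    P′-unique : Unique P′
    P′-unique = Unique-resp-↭ (↭-sym P′↭) (¬Any⇒All¬ P w∉P ∷ P-unique)
    to : ∀ {x} → x ∈ P′ → x ∈ P ⊎ x ≡ w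
    to x∈ with ∈-resp-↭ P′↭ x∈
    ... | here x≡w  = inj₂ x≡w
    ... | there x∈P = inj₁ x∈P
    from : ∀ {x} → x ∈ P ⊎ x ≡ w → x ∈ P′
    from (inj₁ x∈P) = ∈-resp-↭ (↭-sym P′↭) (there x∈P)
    from (inj₂ x≡w) = ∈-resp-↭ (↭-sym P′↭) (here x≡w)

  insertion-extends : ∀ xs {c d ys v} → IsPath T (xs ++ c ∷ d ∷ ys) → v ∉ xs ++ c ∷ d ∷ ys →
                      c ⟶ v → v ⟶ d → Extendable T (xs ++ c ∷ d ∷ ys)
  insertion-extends xs {c} {d} {ys} {v} (P-unique , P-linked) v∉P c⟶v v⟶d =
    ↭-extension P-unique v∉P P′-linked P′↭ (head-++-∷ xs)
      (trans (last-++-∷ xs c (v ∷ d ∷ ys)) (sym (last-++-∷ xs c (d ∷ ys))))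
    where
    split = Linked-split xs P-linked
    P′-linked : Linked _⟶_ (xs ++ c ∷ v ∷ d ∷ ys)
    P′-linked = Linked-join xs (proj₁ split) (c⟶v ∷ v⟶d ∷ Linked.tail (proj₂ split))
    P′↭ : xs ++ c ∷ v ∷ d ∷ ys ↭ v ∷ xs ++ c ∷ d ∷ ys
    P′↭ = ↭-trans (++⁺ˡ xs (↭-swap c v ↭-refl)) (shift v xs (c ∷ d ∷ ys))

  -- u X a b Y z becomes u b Y w X a z.
  rotation-extends : ∀ xs {u a b ys z w} → IsPath T (u ∷ (xs ++ a ∷ b ∷ ys) ∷ʳ z) →
                     w ∉ u ∷ (xs ++ a ∷ b ∷ ys) ∷ʳ z →
                     Linked _⟶_ (u ∷ b ∷ ys ∷ʳ w) → Linked _⟶_ (w ∷ xs ++ a ∷ z ∷ []) →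
                     Extendable T (u ∷ (xs ++ a ∷ b ∷ ys) ∷ʳ z)
  rotation-extends xs {u} {a} {b} {ys} {z} {w} (P-unique , _) w∉P first-leg second-leg =
    ↭-extension P-unique w∉P (Linked-join (u ∷ b ∷ ys) first-leg second-leg) P′↭ refl same-last
    where
    P′↭ : u ∷ (b ∷ ys) ++ w ∷ xs ++ a ∷ z ∷ [] ↭ w ∷ u ∷ (xs ++ a ∷ b ∷ ys) ∷ʳ z
    P′↭ = begin
      u ∷ (b ∷ ys) ++ w ∷ xs ++ a ∷ z ∷ []   ↭⟨ ↭-prep u (shift w (b ∷ ys) _) ⟩
      u ∷ w ∷ (b ∷ ys) ++ xs ++ a ∷ z ∷ []   ↭⟨ ↭-swap u w ↭-refl ⟩
      w ∷ u ∷ (b ∷ ys) ++ xs ++ a ∷ z ∷ []   ↭⟨ ↭-prep w (↭-prep u (shifts (b ∷ ys) xs)) ⟩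
      w ∷ u ∷ xs ++ (b ∷ ys) ++ a ∷ z ∷ []   ↭⟨ ↭-prep w (↭-prep u (++⁺ˡ xs (shift a (b ∷ ys) [ z ]))) ⟩
      w ∷ u ∷ xs ++ a ∷ b ∷ ys ++ z ∷ []     ≡⟨ cong (λ l → w ∷ u ∷ l) (++-assoc xs (a ∷ b ∷ ys) [ z ]) ⟨
      w ∷ u ∷ (xs ++ a ∷ b ∷ ys) ∷ʳ z        ∎
      where open PermutationReasoning
    same-last : last (u ∷ (b ∷ ys) ++ w ∷ xs ++ a ∷ z ∷ []) ≡ last (u ∷ (xs ++ a ∷ b ∷ ys) ∷ʳ z)
    same-last = trans (last-++-∷ (u ∷ b ∷ ys) w _)
                  (trans (last-++-∷ (w ∷ xs) a [ z ]) (sym (last-++-∷ (u ∷ xs ++ a ∷ b ∷ ys) z [])))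

  module OutsideVertex {P} (P-path : IsPath T P) (¬ext : ¬ Extendable T P) {v} (v∉P : v ∉ P) where

    in-arc-step : ∀ xs {c d ys} → xs ++ c ∷ d ∷ ys ≡ P → c ⟶ v → d ⟶ v
    in-arc-step xs {c} {d} refl c⟶v with Arc? T d v
    ... | yes d⟶v = d⟶v
    ... | no ¬d⟶v = contradiction (insertion-extends xs P-path v∉P c⟶v (⟶-connex d≢v ¬d⟶v)) ¬ext
      where d≢v = ∈∧∉⇒≢ (∈-++⁺ʳ xs (there (here refl))) v∉P

    out-arc-step : ∀ xs {c d ys} → xs ++ c ∷ d ∷ ys ≡ P → v ⟶ d → v ⟶ c
    out-arc-step xs {c} eq v⟶d with Arc? T v c
    ... | yes v⟶c = v⟶c
    ... | no ¬v⟶c = contradiction (in-arc-step xs eq (⟶-connex v≢c ¬v⟶c)) (⟶-asymmetric v⟶d)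
      where v≢c = ∈∧∉⇒≢ (subst (c ∈_) eq (∈-++⁺ʳ xs (here refl))) v∉P ∘ sym

    in-arcs-propagate : Linked (λ c d → c ⟶ v → d ⟶ v) P
    in-arcs-propagate = splits⇒Linked P in-arc-step

    out-arcs-propagate : Linked (λ c d → v ⟶ d → v ⟶ c) P
    out-arcs-propagate = splits⇒Linked P out-arc-step

  ¬Dominating⇒Linked-∷ʳ : ∀ {w xs} → w ∉ xs → Linked _⟶_ xs → Linked (λ c d → w ⟶ d → w ⟶ c) xs →
                          ¬ Dominating T w xs → Linked _⟶_ (xs ∷ʳ w)
  ¬Dominating⇒Linked-∷ʳ {xs = []}    _   _ _ ¬dominating = contradiction [] ¬dominating
  ¬Dominating⇒Linked-∷ʳ {xs = x ∷ []} w∉ _ _ ¬dominating =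
    ⟶-connex (∈∧∉⇒≢ (here refl) w∉ ∘ sym) (λ w⟶x → ¬dominating (w⟶x ∷ [])) ∷ [-]
  ¬Dominating⇒Linked-∷ʳ {xs = x ∷ y ∷ ys} w∉ (x⟶y ∷ linked) (back ∷ backs) ¬dominating =
    x⟶y ∷ ¬Dominating⇒Linked-∷ʳ (w∉ ∘ there) linked backs
            (λ dominating → ¬dominating (back (All.head dominating) ∷ dominating))

  hybrid-cycle : ∀ {w Q} → w ∉ Q → Linked _⟶_ Q →
                 Linked (λ c d → c ⟶ w → d ⟶ w) Q → Linked (λ c d → w ⟶ d → w ⟶ c) Q →
                 ¬ Dominating T w Q → ¬ Dominated T w Q → Linked _⟶_ (w ∷ Q ∷ʳ w)
  hybrid-cycle {Q = []}    _   _ _ _ _ ¬dominated = contradiction [] ¬dominated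
  hybrid-cycle {Q = q ∷ _} w∉Q Q-linked in-arcs out-arcs ¬dominating ¬dominated =
    ⟶-connex (∈∧∉⇒≢ (here refl) w∉Q) (¬dominated ∘ propagate-forward in-arcs)
      ∷ ¬Dominating⇒Linked-∷ʳ w∉Q Q-linked out-arcs ¬dominating

  module NonExtendablePath {u₀ Q uₗ} (P-path : IsPath T (u₀ ∷ Q ∷ʳ uₗ)) (¬ext : ¬ Extendable T (u₀ ∷ Q ∷ʳ uₗ)) where

    P : List (Fin n)
    P = u₀ ∷ Q ∷ʳ uₗ

    inner-Linked : ∀ {R : Fin n → Fin n → Set} → Linked R P → Linked R Q
    inner-Linked = Linked-++⁻ˡ Q ∘ Linked.tail

    Q⊆P : ∀ {v} → v ∈ Q → v ∈ P
    Q⊆P = there ∘ ∈-++⁺ˡ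

    uₗ∈P : uₗ ∈ P
    uₗ∈P = there (∈-++⁺ʳ Q (here refl))

    u₀∉Q : u₀ ∉ Q
    u₀∉Q = Unique.Unique[x∷xs]⇒x∉xs (proj₁ P-path) ∘ ∈-++⁺ˡ

    uₗ∉Q : uₗ ∉ Q
    uₗ∉Q with _ ∷ Q∷ʳuₗ-unique ← proj₁ P-path =
      Unique.Unique[x∷xs]⇒x∉xs (Unique-resp-↭ (↭-sym (∷↭∷ʳ uₗ Q)) Q∷ʳuₗ-unique)

    hybℕ : Fin n → ℕ
    hybℕ v = 𝟙 (Hybrid? T P P v)

    -- 2 h(P) + d⁺(u₀) + d⁻(uₗ) and d⁻(u₀) + d⁺(uₗ), counted vertex by vertex.
    F G : Fin n → ℕ
    F v = hybℕ v + hybℕ v + arcℕ u₀ v + arcℕ v uₗ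
    G v = arcℕ v u₀ + arcℕ uₗ v

    F-on-P : ∀ {v} → v ∈ P → F v ≡ arcℕ u₀ v + arcℕ v uₗ
    F-on-P {v} v∈P =
      cong (λ k → k + k + arcℕ u₀ v + arcℕ v uₗ) (𝟙-no (Hybrid? T P P v) (λ hybrid → proj₁ hybrid v∈P))

    outside-P : ∀ {v} → v ∉ P → F v ≤ G v
    outside-P {v} v∉P = bound (Hybrid? T P P v)
      where
      open OutsideVertex P-path ¬ext v∉P
      dominated : u₀ ⟶ v → Dominated T v P
      dominated = propagate-forward in-arcs-propagate
      dominating : v ⟶ uₗ → Dominating T v P
      dominating = propagate-backward (u₀ ∷ Q) out-arcs-propagate
      bound : (d : Dec (Hybrid T P P v)) → 𝟙 d + 𝟙 d + arcℕ u₀ v + arcℕ v uₗ ≤ G v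
      bound (yes (_ , ¬dominating , ¬dominated))
        rewrite 𝟙-no (Arc? T u₀ v) (¬dominated ∘ dominated)
              | 𝟙-no (Arc? T v uₗ) (¬dominating ∘ dominating)
              | 𝟙-yes (Arc? T v u₀) (⟶-connex (∈∧∉⇒≢ (here refl) v∉P) (¬dominated ∘ dominated))
              | 𝟙-yes (Arc? T uₗ v) (⟶-connex (∈∧∉⇒≢ uₗ∈P v∉P ∘ sym) (¬dominating ∘ dominating)) = ≤-refl
      bound (no _) = ≤-trans (≤-reflexive (+-comm (arcℕ u₀ v) (arcℕ v uₗ)))
        (+-mono-≤ (𝟙-mono (Arc? T v uₗ) (Arc? T v u₀) (All.head ∘ dominating))
                  (𝟙-mono (Arc? T u₀ v) (Arc? T uₗ v) (λ u₀⟶v → All.lookup (dominated u₀⟶v) uₗ∈P)))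

    module ClosingCycle {w} (w∉P : w ∉ P) (cycle : Linked _⟶_ (w ∷ Q ∷ʳ w)) where

      crossing-step : ∀ xs {a b ys} → xs ++ a ∷ b ∷ ys ≡ Q → u₀ ⟶ b → uₗ ⟶ a
      crossing-step xs {a} {b} {ys} refl u₀⟶b with Arc? T uₗ a
      ... | yes uₗ⟶a = uₗ⟶a
      ... | no ¬uₗ⟶a =
        contradiction (rotation-extends xs P-path w∉P (u₀⟶b ∷ Linked.tail (proj₂ legs))
                         (Linked-join (w ∷ xs) (proj₁ legs) (a⟶uₗ ∷ [-]))) ¬ext
        where
        a⟶uₗ = ⟶-connex (∈∧∉⇒≢ (∈-++⁺ʳ xs (here refl)) uₗ∉Q ∘ sym) ¬uₗ⟶a
        legs = Linked-split (w ∷ xs) (subst (λ l → Linked _⟶_ (w ∷ l)) (++-assoc xs (a ∷ b ∷ ys) [ w ]) cycle)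

      out-u₀≤in-uₗ+1 : ∑ Q (arcℕ u₀) ≤ suc (∑ Q (arcℕ uₗ))
      out-u₀≤in-uₗ+1 = ∑-≤-shift Q (splits⇒Linked Q crossing-step)
        (λ {a} {b} u₀⟶b⇒uₗ⟶a → 𝟙-mono (Arc? T u₀ b) (Arc? T uₗ a) u₀⟶b⇒uₗ⟶a) (λ v → 𝟙≤1 (Arc? T u₀ v))

      F-on-Q : ∑ Q F ≡ ∑ Q (arcℕ u₀) + ∑ Q (λ v → arcℕ v uₗ)
      F-on-Q = trans (∑-cong (F-on-P ∘ Q⊆P)) (∑-+ Q (arcℕ u₀) (λ v → arcℕ v uₗ))

      F≤G-on-Q : ∑ Q F ≤ ∑ Q G + 2
      F≤G-on-Q = begin
        ∑ Q F                                              ≡⟨ F-on-Q ⟩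
        ∑ Q (arcℕ u₀) + ∑ Q (λ v → arcℕ v uₗ)              ≤⟨ balance pairs out-u₀≤in-uₗ+1 ⟩
        ∑ Q (λ v → arcℕ v u₀) + ∑ Q (arcℕ uₗ) + 2          ≡⟨ cong (_+ 2) (∑-+ Q (λ v → arcℕ v u₀) (arcℕ uₗ)) ⟨
        ∑ Q G + 2                                          ∎
        where
        open ≤-Reasoning
        pairs : ∑ Q (arcℕ u₀) + ∑ Q (λ v → arcℕ v u₀) ≡ ∑ Q (arcℕ uₗ) + ∑ Q (λ v → arcℕ v uₗ)
        pairs = trans (∑-complementary Q _ _ (λ v∈Q → arcℕ-pair (∈∧∉⇒≢ v∈Q u₀∉Q ∘ sym)))
                 (sym (∑-complementary Q _ _ (λ v∈Q → arcℕ-pair (∈∧∉⇒≢ v∈Q uₗ∉Q ∘ sym))))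

      F≤G-on-P : ∑ P F ≤ ∑ P G + 4
      F≤G-on-P = begin
        ∑ P F                       ≡⟨ ∑-∷-∷ʳ u₀ Q uₗ F ⟩
        F u₀ + ∑ Q F + F uₗ         ≤⟨ +-mono-≤ (+-mono-≤ F-u₀≤1 F≤G-on-Q) F-uₗ≤1 ⟩
        1 + (∑ Q G + 2) + 1         ≡⟨ rearrange (∑ Q G) ⟩
        ∑ Q G + 4                   ≤⟨ +-monoˡ-≤ 4 (≤-trans (m≤n+m (∑ Q G) (G u₀)) (m≤m+n _ (G uₗ))) ⟩
        G u₀ + ∑ Q G + G uₗ + 4     ≡⟨ cong (_+ 4) (∑-∷-∷ʳ u₀ Q uₗ G) ⟨
        ∑ P G + 4                   ∎
        where
        open ≤-Reasoning
        rearrange : ∀ x → 1 + (x + 2) + 1 ≡ x + 4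
        rearrange x = solve (x List.∷ List.[])
        F-u₀≤1 : F u₀ ≤ 1
        F-u₀≤1 rewrite F-on-P (here refl) | 𝟙-no (Arc? T u₀ u₀) ⟶-irreflexive = 𝟙≤1 (Arc? T u₀ uₗ)
        F-uₗ≤1 : F uₗ ≤ 1
        F-uₗ≤1 rewrite F-on-P uₗ∈P | 𝟙-no (Arc? T uₗ uₗ) ⟶-irreflexive | +-comm (arcℕ u₀ uₗ) 0 = 𝟙≤1 (Arc? T u₀ uₗ)

      degree-inequality : h T P + h T P + outdeg T u₀ + indeg T uₗ ≤ indeg T u₀ + outdeg T uₗ + 4
      degree-inequality = begin
        h T P + h T P + outdeg T u₀ + indeg T uₗ ≡⟨ ∑F ⟨
        ∑ V F                                    ≤⟨ ∑-≤-by-parts Fin._≟_ P F G 4 ∈-allFin (Unique.allFin⁺ n)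
                                                      (proj₁ P-path) outside-P F≤G-on-P ⟩
        ∑ V G + 4                                ≡⟨ cong (_+ 4) ∑G ⟩
        indeg T u₀ + outdeg T uₗ + 4             ∎
        where
        open ≤-Reasoning
        V = allFin n
        count : ∀ {S : Fin n → Set} (S? : Decidable S) → length (filter S? V) ≡ ∑ V (𝟙 ∘ S?)
        count S? = length-filter≡∑𝟙 S? V
        ∑F : ∑ V F ≡ h T P + h T P + outdeg T u₀ + indeg T uₗ
        ∑F = begin-equality
          ∑ V F                                                        ≡⟨ ∑-+ V _ _ ⟩
          ∑ V (λ v → hybℕ v + hybℕ v + arcℕ u₀ v) + ∑ V (λ v → arcℕ v uₗ) ≡⟨ cong (_+ ∑ V (λ v → arcℕ v uₗ)) (∑-+ V _ _) ⟩
          ∑ V (λ v → hybℕ v + hybℕ v) + ∑ V (arcℕ u₀) + ∑ V (λ v → arcℕ v uₗ)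
            ≡⟨ cong (λ k → k + ∑ V (arcℕ u₀) + ∑ V (λ v → arcℕ v uₗ)) (∑-+ V hybℕ hybℕ) ⟩
          ∑ V hybℕ + ∑ V hybℕ + ∑ V (arcℕ u₀) + ∑ V (λ v → arcℕ v uₗ)
            ≡⟨ cong₂ _+_ (cong₂ _+_ (cong₂ _+_ (count (Hybrid? T P P)) (count (Hybrid? T P P)))
                                    (count (Arc? T u₀))) (count (λ v → Arc? T v uₗ)) ⟨
          h T P + h T P + outdeg T u₀ + indeg T uₗ                     ∎
        ∑G : ∑ V G ≡ indeg T u₀ + outdeg T uₗ
        ∑G = trans (∑-+ V _ _) (sym (cong₂ _+_ (count (λ v → Arc? T v u₀)) (count (Arc? T uₗ))))

    h≤irregularity+2 : ∀ {w} → Hybrid T P Q w → h T P ≤ irregularity T + 2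
    h≤irregularity+2 (w∉P , ¬dominating , ¬dominated) =
      halve degree-inequality (indeg≤outdeg+irregularity u₀) (outdeg≤indeg+irregularity uₗ)
      where
      open OutsideVertex P-path ¬ext w∉P
      open ClosingCycle w∉P (hybrid-cycle (w∉P ∘ Q⊆P) (inner-Linked (proj₂ P-path))
                            (inner-Linked in-arcs-propagate) (inner-Linked out-arcs-propagate)
                            ¬dominating ¬dominated)

lemma5 : ∀ {n : ℕ} (T : Tournament n) (P : List (Fin n)) →
    IsPath T P → length P < n → 4 ≤ length P → ¬ Extendable T P →
    ∃ (λ w → Hybrid T P (inner P) w) →
    h T P ≤ irregularity T + 2
lemma5 T [] _ _ () _ _
lemma5 T (u₀ ∷ rest) P-path _ 4≤|P| ¬ext (w , w-hybrid) with initLast rest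
... | []       = contradiction 4≤|P| λ { (s≤s ()) }
... | Q ∷ʳ′ uₗ =
  NonExtendablePath.h≤irregularity+2 T P-path ¬ext
    (subst (λ Q′ → Hybrid T (u₀ ∷ Q ∷ʳ uₗ) Q′ w) (inner-∷-∷ʳ u₀ Q uₗ) w-hybrid)
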